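{- Let $\sigma\in S^*$ with $\sigma(1)\ne1$, and write $\sigma(1)=0w1$ for a finite word $w$. Then $\sigma(0\overline1)=0\,\overline{w01}$. In particular, $1w0$ is a circular shift (cyclic conjugate) of $\sigma(1)$.
   Context: For $h\ge0$, $\tau_h$ is the substitution on $\{0,1\}$ with $\tau_h(0)=0^{h+1}1$, $\tau_h(1)=0^h1$, extended to finite and infinite words by concatenation; $S^*$ is the set of finite compositions of the $\tau_h$ (including the identity). $\overline v$ denotes the infinite periodic word $vvv\cdots$; $\overline1=111\cdots$. -}

module Defs where

open import Data.Nat using (ℕ; zero; suc; _%_)
open import Data.List using (List; []; _∷_; _++_; concatMap; replicate; length)

data Bit : Set where
  𝟎 𝟏 : Bit

τ : ℕ → Bit → List Bit
τ h 𝟎 = replicate (suc h) 𝟎 ++ 𝟏 ∷ []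
τ h 𝟏 = replicate h 𝟎 ++ 𝟏 ∷ []

τʷ : ℕ → List Bit → List Bit
τʷ h u = concatMap (τ h) u

-- An element of S* is represented by the list [h₁, …, hₖ] standing for
-- τ_{h₁} ∘ ⋯ ∘ τ_{hₖ}  (the empty list is the identity).
S* : Set
S* = List ℕ

applyW : S* → List Bit → List Bit
applyW []       u = u
applyW (h ∷ hs) u = τʷ h (applyW hs u)

InfWord : Set
InfWord = ℕ → Bit

prefix : InfWord → ℕ → List Bit
prefix x zero    = []
prefix x (suc n) = x zero ∷ prefix (λ i → x (suc i)) n

-- lookup with a default (only used at in-range indices)
lookupD : List Bit → ℕ → Bit
lookupD []      _       = 𝟎
lookupD (a ∷ u) zero    = a
lookupD (a ∷ u) (suc i) = lookupD u i

-- τ_h on infinite words: since every image τ_h(a) is nonempty, letter i of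
-- τ_h(x) lies inside τ_h(x₀ x₁ ⋯ x_i).
τω : ℕ → InfWord → InfWord
τω h x i = lookupD (τʷ h (prefix x (suc i))) i

applyω : S* → InfWord → InfWord
applyω []       x = x
applyω (h ∷ hs) x = τω h (applyω hs x)

_◂_ : Bit → InfWord → InfWord
(a ◂ x) zero    = a
(a ◂ x) (suc i) = x i

ones : InfWord
ones _ = 𝟏

periodic : List Bit → InfWord
periodic []      _ = 𝟎
periodic (a ∷ v) i = lookupD (a ∷ v) (i % suc (length v))

-- Write σ(0 1^ω) = 0 y.  Since τ_h(0) = 0 τ_h(1), applying τ_h to 0 y gives 0 y' with
-- y' = τ_h(1) τ_h(y).  If y = z z z ⋯ and τ_h(z) = A τ_h(1), then
-- y' = τ_h(1) (A τ_h(1)) (A τ_h(1)) ⋯ = (τ_h(1) A)(τ_h(1) A) ⋯, so the period evolves as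
-- z ↦ τ_h(1) A.  By induction on σ, either σ(1) = 1 and z = 1, or σ(1) = 0w1 and z = w01.
-- The conjugacy is carried along too: if 0w1 = uv and 1w0 = vu, then τ_h(u) = A 1 since
-- every nonempty τ_h-image ends with 1, so τ_h(1w0) = τ_h(v) A 1, and moving its final 1
-- to the front gives 1w'0 = 1 τ_h(v) A, a conjugate of τ_h(0w1) = A 1 τ_h(v).
module Submission where

open import Defs
open import Data.List using (List; []; _∷_; _++_)
open import Data.Product using (_×_; ∃₂)
open import Relation.Binary.PropositionalEquality using (_≡_; _≢_)

open import Data.Empty using (⊥-elim)
open import Data.List using (length; replicate)
open import Data.List.Properties
  using (++-assoc; ++-identityʳ; ++-cancelʳ; length-++; ∷-injectiveʳ; concatMap-++)
open import Data.Nat using (ℕ; zero; suc; _+_; _<_; _≤_; z≤n; s≤s; z<s; s<s; _%_)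
open import Data.Nat.DivMod using (n%1≡0; m<n⇒m%n≡m; [m+n]%n≡m%n)
open import Data.Nat.Induction using (<-rec)
open import Data.Nat.Properties
  using (≤-total; ≤-trans; ≤-reflexive; +-comm; +-mono-≤; m≤n+m; m≤n⇒∃[o]m+o≡n)
open import Data.Product using (∃; _,_)
open import Data.Sum using (inj₁; inj₂)
open import Relation.Binary.PropositionalEquality
  using (refl; sym; trans; cong; cong₂; _≗_; module ≡-Reasoning)

infixr 5 _++ω_
infix 4 _⊑_

_++ω_ : List Bit → InfWord → InfWord
[]      ++ω x = x
(a ∷ u) ++ω x = a ◂ (u ++ω x)

_⊑_ : List Bit → InfWord → Set
u ⊑ x = ∀ {i} → i < length u → lookupD u i ≡ x i

Conjugate : List Bit → List Bit → Set
Conjugate r s = ∃₂ λ u v → r ≡ u ++ v × s ≡ v ++ u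

data Position (L : ℕ) : ℕ → Set where
  inside : ∀ {i} → i < L → Position L i
  beyond : ∀ j → Position L (L + j)

position : ∀ L i → Position L i
position zero    i       = beyond i
position (suc L) zero    = inside z<s
position (suc L) (suc i) with position L i
... | inside i<L = inside (s<s i<L)
... | beyond j   = beyond j

replicate-++-∷ : ∀ {A : Set} n (a : A) u → replicate n a ++ a ∷ u ≡ a ∷ replicate n a ++ u
replicate-++-∷ zero    a u = refl
replicate-++-∷ (suc n) a u = cong (a ∷_) (replicate-++-∷ n a u)

lookupD-++ˡ : ∀ u v {i} → i < length u → lookupD (u ++ v) i ≡ lookupD u i
lookupD-++ˡ (a ∷ u) v {zero}  _         = refl
lookupD-++ˡ (a ∷ u) v {suc i} (s<s i<n) = lookupD-++ˡ u v i<n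

⊑-++ω : ∀ u x → u ⊑ u ++ω x
⊑-++ω (a ∷ u) x {zero}  _         = refl
⊑-++ω (a ∷ u) x {suc i} (s<s i<n) = ⊑-++ω u x i<n

++-⊑-++ω : ∀ u {v x} → v ⊑ x → u ++ v ⊑ u ++ω x
++-⊑-++ω []      v⊑x                 = v⊑x
++-⊑-++ω (a ∷ u) v⊑x {zero}  _         = refl
++-⊑-++ω (a ∷ u) v⊑x {suc i} (s<s i<n) = ++-⊑-++ω u v⊑x i<n

++ω-lookupʳ : ∀ u x j → (u ++ω x) (length u + j) ≡ x j
++ω-lookupʳ []      x j = refl
++ω-lookupʳ (a ∷ u) x j = ++ω-lookupʳ u x j

◂-cong : ∀ a {x y} → x ≗ y → a ◂ x ≗ a ◂ y
◂-cong a x≗y zero    = refl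
◂-cong a x≗y (suc i) = x≗y i

++ω-cong : ∀ u {x y} → x ≗ y → u ++ω x ≗ u ++ω y
++ω-cong []      x≗y = x≗y
++ω-cong (a ∷ u) x≗y = ◂-cong a (++ω-cong u x≗y)

++-++ω : ∀ u v x → (u ++ v) ++ω x ≗ u ++ω v ++ω x
++-++ω []      v x i = refl
++-++ω (a ∷ u) v x   = ◂-cong a (++-++ω u v x)

++ω-rotate : ∀ u v {x} → x ≗ (u ++ v) ++ω x → v ++ω x ≗ (v ++ u) ++ω v ++ω x
++ω-rotate u v {x} x-fix i = begin
  (v ++ω x) i               ≡⟨ ++ω-cong v (λ k → trans (x-fix k) (++-++ω u v x k)) i ⟩
  (v ++ω u ++ω v ++ω x) i   ≡⟨ sym (++-++ω v u (v ++ω x) i) ⟩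
  ((v ++ u) ++ω v ++ω x) i  ∎
  where open ≡-Reasoning

periodic-unfold : ∀ z → periodic z ≗ z ++ω periodic z
periodic-unfold []      i = refl
periodic-unfold (a ∷ v) i with position (suc (length v)) i
... | inside i<L =
  trans (cong (lookupD (a ∷ v)) (m<n⇒m%n≡m i<L)) (⊑-++ω (a ∷ v) _ i<L)
... | beyond j = begin
  lookupD (a ∷ v) ((L + j) % L)  ≡⟨ cong (λ k → lookupD (a ∷ v) (k % L)) (+-comm L j) ⟩
  lookupD (a ∷ v) ((j + L) % L)  ≡⟨ cong (lookupD (a ∷ v)) ([m+n]%n≡m%n j L) ⟩
  periodic (a ∷ v) j             ≡⟨ sym (++ω-lookupʳ (a ∷ v) _ j) ⟩
  ((a ∷ v) ++ω periodic (a ∷ v)) (L + j) ∎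
  where
  open ≡-Reasoning
  L = suc (length v)

++ω-fixpoint-unique : ∀ {z x y} → z ≢ [] → x ≗ z ++ω x → y ≗ z ++ω y → x ≗ y
++ω-fixpoint-unique {[]}    z≢[] = ⊥-elim (z≢[] refl)
++ω-fixpoint-unique {a ∷ u} {x} {y} _ x-fix y-fix = <-rec (λ i → x i ≡ y i) agree
  where
  z = a ∷ u
  agree : ∀ i → (∀ {j} → j < i → x j ≡ y j) → x i ≡ y i
  agree i below with position (length z) i
  ... | inside i<L = begin
    x i          ≡⟨ x-fix i ⟩
    (z ++ω x) i  ≡⟨ sym (⊑-++ω z x {i} i<L) ⟩
    lookupD z i  ≡⟨ ⊑-++ω z y {i} i<L ⟩
    (z ++ω y) i  ≡⟨ sym (y-fix i) ⟩
    y i          ∎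
    where open ≡-Reasoning
  ... | beyond j = begin
    x (length z + j)          ≡⟨ x-fix _ ⟩
    (z ++ω x) (length z + j)  ≡⟨ ++ω-lookupʳ z x j ⟩
    x j                       ≡⟨ below (s≤s (m≤n+m j (length u))) ⟩
    y j                       ≡⟨ sym (++ω-lookupʳ z y j) ⟩
    (z ++ω y) (length z + j)  ≡⟨ sym (y-fix _) ⟩
    y (length z + j)          ∎
    where open ≡-Reasoning

fixpoint-periodic : ∀ {z y} → z ≢ [] → y ≗ z ++ω y → y ≗ periodic z
fixpoint-periodic {z} z≢[] y-fix = ++ω-fixpoint-unique z≢[] y-fix (periodic-unfold z)

length-prefix : ∀ x n → length (prefix x n) ≡ n
length-prefix x zero    = refl
length-prefix x (suc n) = cong suc (length-prefix (λ i → x (suc i)) n)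

prefix-+ : ∀ x m k → prefix x (m + k) ≡ prefix x m ++ prefix (λ i → x (m + i)) k
prefix-+ x zero    k = refl
prefix-+ x (suc m) k = cong (x zero ∷_) (prefix-+ (λ i → x (suc i)) m k)

prefix-cong : ∀ {x y} → x ≗ y → ∀ n → prefix x n ≡ prefix y n
prefix-cong x≗y zero    = refl
prefix-cong x≗y (suc n) = cong₂ _∷_ (x≗y zero) (prefix-cong (λ i → x≗y (suc i)) n)

τʷ-++ : ∀ h u v → τʷ h (u ++ v) ≡ τʷ h u ++ τʷ h v
τʷ-++ h = concatMap-++ (τ h)

τʷ-snoc : ∀ h u a → τʷ h (u ++ a ∷ []) ≡ τʷ h u ++ τ h a
τʷ-snoc h u a = trans (τʷ-++ h u (a ∷ [])) (cong (τʷ h u ++_) (++-identityʳ (τ h a)))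

τ𝟏-++-≢[] : ∀ h u → τ h 𝟏 ++ u ≢ []
τ𝟏-++-≢[] zero    u ()
τ𝟏-++-≢[] (suc h) u ()

length-τ : ∀ h a → 1 ≤ length (τ h a)
length-τ h       𝟎 = s≤s z≤n
length-τ zero    𝟏 = s≤s z≤n
length-τ (suc h) 𝟏 = s≤s z≤n

length-τ-++ : ∀ h a v {n} → n ≤ length v → suc n ≤ length (τ h a ++ v)
length-τ-++ h a v n≤ =
  ≤-trans (+-mono-≤ (length-τ h a) n≤) (≤-reflexive (sym (length-++ (τ h a))))

length-τʷ : ∀ h u → length u ≤ length (τʷ h u)
length-τʷ h []      = z≤n
length-τʷ h (a ∷ u) = length-τ-++ h a (τʷ h u) (length-τʷ h u)

τʷ-ends-with-𝟏 : ∀ h a u → ∃ λ A → τʷ h (a ∷ u) ≡ A ++ 𝟏 ∷ []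
τʷ-ends-with-𝟏 h 𝟎 []      = replicate (suc h) 𝟎 , ++-identityʳ (τ h 𝟎)
τʷ-ends-with-𝟏 h 𝟏 []      = replicate h 𝟎 , ++-identityʳ (τ h 𝟏)
τʷ-ends-with-𝟏 h a (b ∷ u) with τʷ-ends-with-𝟏 h b u
... | A , eq = τ h a ++ A , trans (cong (τ h a ++_) eq) (sym (++-assoc (τ h a) A _))

τʷ-prefix-extends : ∀ h x {m n} → m ≤ n → ∃ λ r → τʷ h (prefix x n) ≡ τʷ h (prefix x m) ++ r
τʷ-prefix-extends h x {m} m≤n with m≤n⇒∃[o]m+o≡n m≤n
... | k , refl = _ , trans (cong (τʷ h) (prefix-+ x m k)) (τʷ-++ h (prefix x m) _)

-- Of two prefixes of x, the τ-image of the shorter one is a prefix of that of the longer.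
τʷ-prefix-⊑ : ∀ h x n → τʷ h (prefix x n) ⊑ τω h x
τʷ-prefix-⊑ h x n {i} i<len with ≤-total n (suc i)
... | inj₁ n≤1+i with τʷ-prefix-extends h x n≤1+i
...   | r , eq = sym (trans (cong (λ u → lookupD u i) eq) (lookupD-++ˡ (τʷ h (prefix x n)) r i<len))
τʷ-prefix-⊑ h x n {i} i<len | inj₂ 1+i≤n with τʷ-prefix-extends h x 1+i≤n
...   | r , eq = trans (cong (λ u → lookupD u i) eq) (lookupD-++ˡ (τʷ h (prefix x (suc i))) r i<τʷ)
  where
  i<τʷ : i < length (τʷ h (prefix x (suc i)))
  i<τʷ = ≤-trans (≤-reflexive (sym (length-prefix x (suc i)))) (length-τʷ h (prefix x (suc i)))

τω-cong : ∀ h {x y} → x ≗ y → τω h x ≗ τω h y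
τω-cong h x≗y i = cong (λ u → lookupD (τʷ h u) i) (prefix-cong x≗y (suc i))

τω-◂ : ∀ h a x → τω h (a ◂ x) ≗ τ h a ++ω τω h x
τω-◂ h a x i = ++-⊑-++ω (τ h a) (τʷ-prefix-⊑ h x i) {i} i<len
  where
  i<len : i < length (τ h a ++ τʷ h (prefix x i))
  i<len = length-τ-++ h a (τʷ h (prefix x i))
            (≤-trans (≤-reflexive (sym (length-prefix x i))) (length-τʷ h (prefix x i)))

τω-++ω : ∀ h u x → τω h (u ++ω x) ≗ τʷ h u ++ω τω h x
τω-++ω h []      x i = refl
τω-++ω h (a ∷ u) x i = begin
  τω h (a ◂ (u ++ω x)) i                  ≡⟨ τω-◂ h a (u ++ω x) i ⟩
  (τ h a ++ω τω h (u ++ω x)) i            ≡⟨ ++ω-cong (τ h a) (τω-++ω h u x) i ⟩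
  (τ h a ++ω τʷ h u ++ω τω h x) i         ≡⟨ sym (++-++ω (τ h a) (τʷ h u) (τω h x) i) ⟩
  ((τ h a ++ τʷ h u) ++ω τω h x) i        ∎
  where open ≡-Reasoning

τω-periodic : ∀ h {z A} → τʷ h z ≡ A ++ τ h 𝟏 →
              τ h 𝟏 ++ω τω h (periodic z) ≗ periodic (τ h 𝟏 ++ A)
τω-periodic h {z} {A} τz≡ = fixpoint-periodic (τ𝟏-++-≢[] h A) (++ω-rotate A (τ h 𝟏) τy-fix)
  where
  τy-fix : τω h (periodic z) ≗ (A ++ τ h 𝟏) ++ω τω h (periodic z)
  τy-fix i = trans (τω-cong h (periodic-unfold z) i)
                   (trans (τω-++ω h z (periodic z) i)
                          (cong (λ u → (u ++ω τω h (periodic z)) i) τz≡))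

τʷ-conjugate-rotate : ∀ h {r s t} → Conjugate r s → τʷ h s ≡ t ++ 𝟏 ∷ [] →
                      Conjugate (τʷ h r) (𝟏 ∷ t)
τʷ-conjugate-rotate h {t = t} ([] , v , refl , refl) τs≡ =
  t , 𝟏 ∷ [] , trans (cong (τʷ h) (sym (++-identityʳ v))) τs≡ , refl
τʷ-conjugate-rotate h {t = t} (a ∷ u , v , refl , refl) τs≡ with τʷ-ends-with-𝟏 h a u
... | A , τu≡ = A , 𝟏 ∷ τʷ h v , τr≡ , cong (𝟏 ∷_) (++-cancelʳ (𝟏 ∷ []) t _ t𝟏≡)
  where
  open ≡-Reasoning
  τr≡ : τʷ h ((a ∷ u) ++ v) ≡ A ++ 𝟏 ∷ τʷ h v
  τr≡ = begin
    τʷ h ((a ∷ u) ++ v)      ≡⟨ τʷ-++ h (a ∷ u) v ⟩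
    τʷ h (a ∷ u) ++ τʷ h v   ≡⟨ cong (_++ τʷ h v) τu≡ ⟩
    (A ++ 𝟏 ∷ []) ++ τʷ h v  ≡⟨ ++-assoc A (𝟏 ∷ []) (τʷ h v) ⟩
    A ++ 𝟏 ∷ τʷ h v          ∎
  t𝟏≡ : t ++ 𝟏 ∷ [] ≡ (τʷ h v ++ A) ++ 𝟏 ∷ []
  t𝟏≡ = begin
    t ++ 𝟏 ∷ []                 ≡⟨ sym τs≡ ⟩
    τʷ h (v ++ a ∷ u)           ≡⟨ τʷ-++ h v (a ∷ u) ⟩
    τʷ h v ++ τʷ h (a ∷ u)      ≡⟨ cong (τʷ h v ++_) τu≡ ⟩
    τʷ h v ++ A ++ 𝟏 ∷ []       ≡⟨ sym (++-assoc (τʷ h v) A _) ⟩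
    (τʷ h v ++ A) ++ 𝟏 ∷ []     ∎

-- Shape r z relates r = σ(1) to the period z of σ(0 1^ω) = 0 z z z ⋯.
data Shape (r z : List Bit) : Set where
  single   : r ≡ 𝟏 ∷ [] → z ≡ 𝟏 ∷ [] → Shape r z
  bordered : ∀ w → r ≡ 𝟎 ∷ w ++ 𝟏 ∷ [] → z ≡ w ++ 𝟎 ∷ 𝟏 ∷ [] →
             Conjugate r (𝟏 ∷ w ++ 𝟎 ∷ []) → Shape r z

shape-step : ∀ h {r z} → Shape r z →
             ∃ λ A → τʷ h z ≡ A ++ τ h 𝟏 × Shape (τʷ h r) (τ h 𝟏 ++ A)
shape-step zero (single refl refl) = [] , refl , single refl refl
shape-step (suc k) (single refl refl) =
  [] , ++-identityʳ _ , bordered 0ᵏ τ𝟏≡ z′≡ (replicate (suc k) 𝟎 , 𝟏 ∷ [] , τ𝟏≡ , rotated)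
  where
  0ᵏ = replicate k 𝟎
  τ𝟏≡ : τʷ (suc k) (𝟏 ∷ []) ≡ 𝟎 ∷ 0ᵏ ++ 𝟏 ∷ []
  τ𝟏≡ = cong (𝟎 ∷_) (++-identityʳ _)
  z′≡ : τ (suc k) 𝟏 ++ [] ≡ 0ᵏ ++ 𝟎 ∷ 𝟏 ∷ []
  z′≡ = trans (++-identityʳ _) (sym (replicate-++-∷ k 𝟎 (𝟏 ∷ [])))
  rotated : 𝟏 ∷ 0ᵏ ++ 𝟎 ∷ [] ≡ 𝟏 ∷ 𝟎 ∷ 0ᵏ
  rotated = cong (𝟏 ∷_) (trans (replicate-++-∷ k 𝟎 []) (cong (𝟎 ∷_) (++-identityʳ 0ᵏ)))
shape-step h (bordered w refl refl conj) =
  τʷ h w ++ τ h 𝟎 , τz≡ , bordered w′ (cong (𝟎 ∷_) τr≡) z′≡ (τʷ-conjugate-rotate h conj τs≡)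
  where
  open ≡-Reasoning
  0ʰ = replicate h 𝟎
  w′ = τ h 𝟏 ++ τʷ h w ++ 0ʰ
  w′-++ : ∀ t → w′ ++ t ≡ τ h 𝟏 ++ τʷ h w ++ 0ʰ ++ t
  w′-++ t = trans (++-assoc (τ h 𝟏) _ t) (cong (τ h 𝟏 ++_) (++-assoc (τʷ h w) 0ʰ t))
  τz≡ : τʷ h (w ++ 𝟎 ∷ 𝟏 ∷ []) ≡ (τʷ h w ++ τ h 𝟎) ++ τ h 𝟏
  τz≡ = begin
    τʷ h (w ++ 𝟎 ∷ 𝟏 ∷ [])           ≡⟨ τʷ-++ h w (𝟎 ∷ 𝟏 ∷ []) ⟩
    τʷ h w ++ τ h 𝟎 ++ τ h 𝟏 ++ []   ≡⟨ cong (λ u → τʷ h w ++ τ h 𝟎 ++ u) (++-identityʳ (τ h 𝟏)) ⟩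
    τʷ h w ++ τ h 𝟎 ++ τ h 𝟏         ≡⟨ sym (++-assoc (τʷ h w) (τ h 𝟎) (τ h 𝟏)) ⟩
    (τʷ h w ++ τ h 𝟎) ++ τ h 𝟏       ∎
  τr≡ : τ h 𝟏 ++ τʷ h (w ++ 𝟏 ∷ []) ≡ w′ ++ 𝟏 ∷ []
  τr≡ = trans (cong (τ h 𝟏 ++_) (τʷ-snoc h w 𝟏)) (sym (w′-++ (𝟏 ∷ [])))
  z′≡ : τ h 𝟏 ++ τʷ h w ++ τ h 𝟎 ≡ w′ ++ 𝟎 ∷ 𝟏 ∷ []
  z′≡ = begin
    τ h 𝟏 ++ τʷ h w ++ τ h 𝟎             ≡⟨ cong (λ u → τ h 𝟏 ++ τʷ h w ++ u) (sym (replicate-++-∷ h 𝟎 (𝟏 ∷ []))) ⟩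
    τ h 𝟏 ++ τʷ h w ++ 0ʰ ++ 𝟎 ∷ 𝟏 ∷ []  ≡⟨ sym (w′-++ (𝟎 ∷ 𝟏 ∷ [])) ⟩
    w′ ++ 𝟎 ∷ 𝟏 ∷ []                     ∎
  τs≡ : τʷ h (𝟏 ∷ w ++ 𝟎 ∷ []) ≡ (w′ ++ 𝟎 ∷ []) ++ 𝟏 ∷ []
  τs≡ = begin
    τ h 𝟏 ++ τʷ h (w ++ 𝟎 ∷ [])  ≡⟨ cong (τ h 𝟏 ++_) (τʷ-snoc h w 𝟎) ⟩
    τ h 𝟏 ++ τʷ h w ++ τ h 𝟎     ≡⟨ z′≡ ⟩
    w′ ++ 𝟎 ∷ 𝟏 ∷ []             ≡⟨ sym (++-assoc w′ (𝟎 ∷ []) (𝟏 ∷ [])) ⟩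
    (w′ ++ 𝟎 ∷ []) ++ 𝟏 ∷ []     ∎

invariant : ∀ σ → ∃ λ z → applyω σ (𝟎 ◂ ones) ≗ 𝟎 ◂ periodic z × Shape (applyW σ (𝟏 ∷ [])) z
invariant [] = 𝟏 ∷ [] , ones≗periodic , single refl refl
  where
  ones≗periodic : 𝟎 ◂ ones ≗ 𝟎 ◂ periodic (𝟏 ∷ [])
  ones≗periodic zero    = refl
  ones≗periodic (suc i) = cong (lookupD (𝟏 ∷ [])) (sym (n%1≡0 i))
invariant (h ∷ σ) with invariant σ
... | z , image , shape with shape-step h shape
...   | A , τz≡ , shape′ = τ h 𝟏 ++ A , image′ , shape′
  where
  -- τ h 𝟎 is definitionally 𝟎 ∷ τ h 𝟏, so τω-◂ already exposes the leading 𝟎.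
  image′ : τω h (applyω σ (𝟎 ◂ ones)) ≗ 𝟎 ◂ periodic (τ h 𝟏 ++ A)
  image′ i = trans (τω-cong h image i)
                   (trans (τω-◂ h 𝟎 (periodic z) i) (◂-cong 𝟎 (τω-periodic h {z} τz≡) i))

lemma3p7 : (σ : S*) → applyW σ (𝟏 ∷ []) ≢ 𝟏 ∷ [] →
    (w : List Bit) → applyW σ (𝟏 ∷ []) ≡ 𝟎 ∷ (w ++ 𝟏 ∷ []) →
    ((i : _) → applyω σ (𝟎 ◂ ones) i ≡ (𝟎 ◂ periodic (w ++ 𝟎 ∷ 𝟏 ∷ [])) i)
    × ∃₂ (λ u v → applyW σ (𝟏 ∷ []) ≡ u ++ v × 𝟏 ∷ (w ++ 𝟎 ∷ []) ≡ v ++ u)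
lemma3p7 σ σ𝟏≢𝟏 w σ𝟏≡ with invariant σ
... | _ , _ , single σ𝟏≡𝟏 _ = ⊥-elim (σ𝟏≢𝟏 σ𝟏≡𝟏)
... | _ , image , bordered w′ σ𝟏≡′ refl conj
  with ++-cancelʳ (𝟏 ∷ []) w′ w (∷-injectiveʳ (trans (sym σ𝟏≡′) σ𝟏≡))
...   | refl = image , conj
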